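{- Let $n\ge 2$ be even and let $\Delta^*_n=\max\{\Delta(\pi):\pi\in\mathcal{S}_n\}$. Then $\Delta^*_n=(n^2-2)/2$, and for $\pi=(\pi_1,\ldots,\pi_n)\in\mathcal{S}_n$ we have $\Delta(\pi)=\Delta^*_n$ if and only if $\pi$ is mid-alternating and $\{\pi_1,\pi_n\}=\{n/2,\,n/2+1\}$.
   Context: $\mathcal{S}_n$ is the set of permutations of $\{1,\ldots,n\}$. The global variation of $\pi$ is $\Delta(\pi)=\sum_{i=1}^{n-1}|\pi_{i+1}-\pi_i|$. For $n=2k$ even, $\pi$ is mid-alternating if for every $i<n$ either ($\pi_i\le k$ and $\pi_{i+1}\ge k+1$) or ($\pi_i\ge k+1$ and $\pi_{i+1}\le k$). -}

module Defs where

open import Data.Nat using (ℕ; zero; suc; _+_; _≤_; ∣_-_∣)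
open import Data.Fin using (Fin; toℕ; inject₁) renaming (zero to fzero; suc to fsuc)
open import Data.Fin.Permutation using (Permutation′; _⟨$⟩ʳ_)
open import Data.Product using (_×_)
open import Data.Sum using (_⊎_)

-- One-line notation π = (π_1,…,π_n): the entry at position p (p : Fin n
-- stands for position toℕ p + 1) is  π_p = toℕ (π ⟨$⟩ʳ p) + 1  ∈ {1,…,n}.
val : ∀ {n} → Permutation′ n → Fin n → ℕ
val π p = suc (toℕ (π ⟨$⟩ʳ p))

sumAdj : ∀ m → (Fin (suc m) → ℕ) → (ℕ → ℕ → ℕ) → ℕ
sumAdj zero v f = 0
sumAdj (suc m) v f = f (v fzero) (v (fsuc fzero)) + sumAdj m (λ i → v (fsuc i)) f

allAdj : ∀ m → (Fin (suc m) → ℕ) → (ℕ → ℕ → Set) → Set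
allAdj zero v P = Data.Unit.⊤
  where import Data.Unit
allAdj (suc m) v P = P (v fzero) (v (fsuc fzero)) × allAdj m (λ i → v (fsuc i)) P

Δ : ∀ m → Permutation′ (suc m) → ℕ
Δ m π = sumAdj m (val π) (λ a b → ∣ b - a ∣)

MidAlternating : ∀ k m → Permutation′ (suc m) → Set
MidAlternating k m π =
  allAdj m (val π) (λ a b → (a ≤ k × suc k ≤ b) ⊎ (suc k ≤ a × b ≤ k))

-- Let D(a) = |2a − (2k+1)| be twice the distance from a to the midpoint k + ½
-- of {1,…,2k}. For any a, b we have 2|b − a| ≤ D(a) + D(b), with equality
-- exactly when a and b lie on opposite sides of the midpoint. Summing along π
-- counts every D(π_i) twice except at the two ends, and Σ_{a ≤ 2k} D(a) = 2k²,
-- so 2Δ(π) ≤ 4k² − D(π_1) − D(π_n) ≤ 4k² − 2, because D ≥ 1 with equality only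
-- at k and k+1. Hence Δ(π) ≤ 2k² − 1, with equality iff both estimates are
-- tight: π is mid-alternating and its ends are k and k+1. The zigzag
-- k, 2k, k−1, 2k−1, …, 1, k+1 attains the bound.
module Submission where

open import Defs
open import Data.Nat using (ℕ; zero; suc; _+_; _*_; _∸_; _≤_; _<_; _/_; ∣_-_∣; z≤n; s≤s; s≤s⁻¹; _≤?_)
open import Data.Nat.Properties
open import Data.Nat.DivMod using (m*n/n≡m)
open import Data.Nat.Tactic.RingSolver using (solve-∀)
open import Data.Fin using (Fin; toℕ; fromℕ; inject₁; cast; remQuot; opposite; zero) renaming (suc to fsuc)
open import Data.Fin.Properties
  using (toℕ-injective; toℕ-fromℕ; toℕ-inject₁; toℕ-cast; toℕ-combine; combine-remQuot; opposite-prop; toℕ<n; *↔×)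
open import Data.Fin.Permutation
  using (Permutation; Permutation′; _⟨$⟩ʳ_; _⟨$⟩ˡ_; _∘ₚ_; cast-id; inverseˡ; reverse)
open import Data.Product using (_×_; _,_; Σ; ∃; ∃₂; proj₁; proj₂)
open import Data.Product.Algebra using (×-comm)
open import Data.Product.Function.NonDependent.Propositional using (_×-↔_; _×-⇔_)
open import Data.Sum using (_⊎_; inj₁; inj₂)
open import Data.Empty using (⊥-elim)
open import Data.Unit using (tt)
open import Function.Base using (_∘_)
open import Function.Bundles using (_⇔_; mk⇔; Equivalence)
open import Function.Construct.Composition using (_↔-∘_; _⇔-∘_)
open import Function.Construct.Identity using (↔-id)
open import Function.Construct.Symmetry using (↔-sym)
open import Relation.Nullary using (¬_; yes; no)
open import Relation.Binary.PropositionalEquality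
open import Algebra.Properties.CommutativeMonoid.Sum +-0-commutativeMonoid using (sum; sum-permute)

open ≡-Reasoning

m+n≡o⇒∣m-o∣≡n : ∀ m n {o} → m + n ≡ o → ∣ m - o ∣ ≡ n
m+n≡o⇒∣m-o∣≡n m n refl = ∣m-m+n∣≡n m n

m+n≡o⇒∣o-m∣≡n : ∀ m n {o} → m + n ≡ o → ∣ o - m ∣ ≡ n
m+n≡o⇒∣o-m∣≡n m n {o} eq = trans (∣-∣-comm o m) (m+n≡o⇒∣m-o∣≡n m n eq)

m+m≤n+n⇒m≤n : ∀ {m n} → m + m ≤ n + n → m ≤ n
m+m≤n+n⇒m≤n {m} {n} m+m≤n+n with m ≤? n
... | yes m≤n = m≤n
... | no m≰n  = ⊥-elim (<⇒≱ (+-mono-< (≰⇒> m≰n) (≰⇒> m≰n)) m+m≤n+n)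

m+m≡n+n⇒m≡n : ∀ {m n} → m + m ≡ n + n → m ≡ n
m+m≡n+n⇒m≡n eq = ≤-antisym (m+m≤n+n⇒m≤n (≤-reflexive eq)) (m+m≤n+n⇒m≤n (≤-reflexive (sym eq)))

+-≡-split : ∀ {a b c d} → a ≤ c → b ≤ d → a + b ≡ c + d → a ≡ c × b ≡ d
+-≡-split {a} {b} {c} {d} a≤c b≤d eq with m≤n⇒m<n∨m≡n a≤c
... | inj₂ refl = refl , +-cancelˡ-≡ a b d eq
... | inj₁ a<c  = ⊥-elim (<⇒≢ (+-mono-<-≤ a<c b≤d) eq)

halve-bound : ∀ {d s e N} → d + d ≤ s → 2 ≤ e → s + e ≡ N + N + 2 → d ≤ N
halve-bound {d} {s} {e} {N} d+d≤s 2≤e eq = m+m≤n+n⇒m≤n (+-cancelʳ-≤ 2 (d + d) (N + N)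
  (≤-trans (+-mono-≤ d+d≤s 2≤e) (≤-reflexive eq)))

halve-bound-≡⇔ : ∀ {d s e N} → d + d ≤ s → 2 ≤ e → s + e ≡ N + N + 2 →
  (d ≡ N) ⇔ (d + d ≡ s × e ≡ 2)
halve-bound-≡⇔ {d} {s} {e} {N} d+d≤s 2≤e eq = mk⇔ tight loose
  where
  tight : d ≡ N → d + d ≡ s × e ≡ 2
  tight refl = let d+d≡s , 2≡e = +-≡-split d+d≤s 2≤e (sym eq) in d+d≡s , sym 2≡e
  loose : d + d ≡ s × e ≡ 2 → d ≡ N
  loose (d+d≡s , e≡2) = m+m≡n+n⇒m≡n (+-cancelʳ-≡ 2 (d + d) (N + N)
    (trans (cong₂ _+_ d+d≡s (sym e≡2)) eq))

half-n²∸2 : ∀ {n} k → 1 ≤ k → n ≡ 2 * k → let N = (n * n ∸ 2) / 2 in N + N + 2 ≡ n * n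
half-n²∸2 (suc k) _ refl = begin
  N + N + 2 ≡⟨ cong (λ t → t + t + 2) (trans (cong (_/ 2) (cong (_∸ 2) (n²≡2+c*2 k))) (m*n/n≡m c 2)) ⟩
  c + c + 2 ≡⟨ c+c+2≡n² k ⟩
  n * n     ∎
  where
  n N c : ℕ
  n = 2 * suc k
  N = (n * n ∸ 2) / 2
  c = 2 * k * k + 4 * k + 1
  n²≡2+c*2 : ∀ k → 2 * suc k * (2 * suc k) ≡ 2 + (2 * k * k + 4 * k + 1) * 2
  n²≡2+c*2 = solve-∀
  c+c+2≡n² : ∀ k → (2 * k * k + 4 * k + 1) + (2 * k * k + 4 * k + 1) + 2 ≡ 2 * suc k * (2 * suc k)
  c+c+2≡n² = solve-∀

-- D(a): twice the distance from a to k + ½, so that it stays in ℕ.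
midDist : ℕ → ℕ → ℕ
midDist k a = ∣ a + a - suc (k + k) ∣

data MidView (k a : ℕ) : Set where
  below : ∀ x → a + x ≡ k → MidView k a
  above : ∀ y → suc k + y ≡ a → MidView k a

midView : ∀ k a → MidView k a
midView k a with a ≤? k
... | yes a≤k = let x , a+x≡k = m≤n⇒∃[o]m+o≡n a≤k in below x a+x≡k
... | no a≰k  = let y , k+y≡a = m≤n⇒∃[o]m+o≡n (≰⇒> a≰k) in above y k+y≡a

midDist-below : ∀ k a {x} → a + x ≡ k → midDist k a ≡ suc (x + x)
midDist-below _ a {x} refl = m+n≡o⇒∣m-o∣≡n (a + a) (suc (x + x)) (lemma a x)
  where
  lemma : ∀ a x → a + a + suc (x + x) ≡ suc (a + x + (a + x))
  lemma = solve-∀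

midDist-above : ∀ k a {y} → suc k + y ≡ a → midDist k a ≡ suc (y + y)
midDist-above k _ {y} refl = m+n≡o⇒∣o-m∣≡n (suc (k + k)) (suc (y + y)) (lemma k y)
  where
  lemma : ∀ k y → suc (k + k) + suc (y + y) ≡ suc k + y + (suc k + y)
  lemma = solve-∀

midDist-suc : ∀ k a → midDist (suc k) (suc a) ≡ midDist k a
midDist-suc k a = trans (cong₂ ∣_-_∣ (+-suc (suc a) a) (cong suc (cong suc (+-suc k k))))
                        (∣m+n-m+o∣≡∣n-o∣ 2 (a + a) (suc (k + k)))

1≤midDist : ∀ k a → 1 ≤ midDist k a
1≤midDist k a with midView k a
... | below x a+x≡k = subst (1 ≤_) (sym (midDist-below k a a+x≡k)) (s≤s z≤n)
... | above y k+y≡a = subst (1 ≤_) (sym (midDist-above k a k+y≡a)) (s≤s z≤n)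

midDist≡1⇔ : ∀ k a → (midDist k a ≡ 1) ⇔ (a ≡ k ⊎ a ≡ suc k)
midDist≡1⇔ k a = mk⇔ to from
  where
  centred : ∀ {x} → suc (x + x) ≡ 1 → x ≡ 0
  centred {x} eq = m+n≡0⇒m≡0 x (suc-injective eq)
  to : midDist k a ≡ 1 → a ≡ k ⊎ a ≡ suc k
  to d≡1 with midView k a
  ... | below x a+x≡k = inj₁ (begin
    a     ≡⟨ +-identityʳ a ⟨
    a + 0 ≡⟨ cong (a +_) (centred (trans (sym (midDist-below k a a+x≡k)) d≡1)) ⟨
    a + x ≡⟨ a+x≡k ⟩
    k     ∎)
  ... | above y k+y≡a = inj₂ (begin
    a         ≡⟨ k+y≡a ⟨
    suc k + y ≡⟨ cong (suc k +_) (centred (trans (sym (midDist-above k a k+y≡a)) d≡1)) ⟩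
    suc k + 0 ≡⟨ +-identityʳ (suc k) ⟩
    suc k     ∎)
  from : a ≡ k ⊎ a ≡ suc k → midDist k a ≡ 1
  from (inj₁ refl) = midDist-below k a (+-identityʳ a)
  from (inj₂ refl) = midDist-above k a (+-identityʳ (suc k))

Straddles : ℕ → ℕ → ℕ → Set
Straddles k a b = (a ≤ k × suc k ≤ b) ⊎ (suc k ≤ a × b ≤ k)

gap-within : ∀ a b c {x y} → ∣ a - c ∣ ≡ x → ∣ c - b ∣ ≡ y → ∣ b - a ∣ ≤ x + y
gap-within a b c ac≡x cb≡y =
  subst (_≤ _) (∣-∣-comm a b) (subst (∣ a - b ∣ ≤_) (cong₂ _+_ ac≡x cb≡y) (∣-∣-triangle a c b))

gap-across : ∀ a x y {k b} → a + x ≡ k → suc k + y ≡ b → a + suc (x + y) ≡ b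
gap-across a x y refl refl = lemma a x y
  where
  lemma : ∀ a x y → a + suc (x + y) ≡ suc (a + x) + y
  lemma = solve-∀

double-< : ∀ x y {t} → t ≤ x + y → t + t < suc (x + x) + suc (y + y)
double-< x y t≤x+y = s≤s (≤-trans (+-mono-≤ t≤x+y t≤x+y)
  (≤-trans (≤-reflexive (lemma x y)) (+-monoʳ-≤ (x + x) (n≤1+n (y + y)))))
  where
  lemma : ∀ x y → x + y + (x + y) ≡ x + x + (y + y)
  lemma = solve-∀

double-across : ∀ x y {t} → t ≡ suc (x + y) → t + t ≡ suc (x + x) + suc (y + y)
double-across x y refl = lemma x y
  where
  lemma : ∀ x y → suc (x + y) + suc (x + y) ≡ suc (x + x) + suc (y + y)
  lemma = solve-∀

GapVersus : ℕ → ℕ → ℕ → ℕ → Set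
GapVersus k a b s = (Straddles k a b × ∣ b - a ∣ + ∣ b - a ∣ ≡ s)
                  ⊎ (¬ Straddles k a b × ∣ b - a ∣ + ∣ b - a ∣ < s)

gap-midDist : ∀ k a b → GapVersus k a b (midDist k a + midDist k b)
gap-midDist k a b with midView k a | midView k b
... | below x a+x≡k | below y b+y≡k =
  subst (GapVersus k a b) (sym (cong₂ _+_ (midDist-below k a a+x≡k) (midDist-below k b b+y≡k)))
    (inj₂ (not-straddling , double-< x y
      (gap-within a b k (m+n≡o⇒∣m-o∣≡n a x a+x≡k) (m+n≡o⇒∣o-m∣≡n b y b+y≡k))))
  where
  not-straddling : ¬ Straddles k a b
  not-straddling (inj₁ (_ , k<b)) = <⇒≱ k<b (m+n≤o⇒m≤o b (≤-reflexive b+y≡k))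
  not-straddling (inj₂ (k<a , _)) = <⇒≱ k<a (m+n≤o⇒m≤o a (≤-reflexive a+x≡k))
... | above x k+x≡a | above y k+y≡b =
  subst (GapVersus k a b) (sym (cong₂ _+_ (midDist-above k a k+x≡a) (midDist-above k b k+y≡b)))
    (inj₂ (not-straddling , double-< x y
      (gap-within a b (suc k) (m+n≡o⇒∣o-m∣≡n (suc k) x k+x≡a) (m+n≡o⇒∣m-o∣≡n (suc k) y k+y≡b))))
  where
  not-straddling : ¬ Straddles k a b
  not-straddling (inj₁ (a≤k , _)) = <⇒≱ (m+n≤o⇒m≤o (suc k) (≤-reflexive k+x≡a)) a≤k
  not-straddling (inj₂ (_ , b≤k)) = <⇒≱ (m+n≤o⇒m≤o (suc k) (≤-reflexive k+y≡b)) b≤k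
... | below x a+x≡k | above y k+y≡b =
  subst (GapVersus k a b) (sym (cong₂ _+_ (midDist-below k a a+x≡k) (midDist-above k b k+y≡b)))
    (inj₁ ( inj₁ (m+n≤o⇒m≤o a (≤-reflexive a+x≡k) , m+n≤o⇒m≤o (suc k) (≤-reflexive k+y≡b))
          , double-across x y (m+n≡o⇒∣o-m∣≡n a (suc (x + y)) (gap-across a x y a+x≡k k+y≡b))))
... | above x k+x≡a | below y b+y≡k =
  subst (GapVersus k a b) (sym (cong₂ _+_ (midDist-above k a k+x≡a) (midDist-below k b b+y≡k)))
    (inj₁ ( inj₂ (m+n≤o⇒m≤o (suc k) (≤-reflexive k+x≡a) , m+n≤o⇒m≤o b (≤-reflexive b+y≡k))
          , double-across x y (trans (m+n≡o⇒∣m-o∣≡n b (suc (y + x)) (gap-across b y x b+y≡k k+x≡a))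
                                     (cong suc (+-comm y x)))))

gap-midDist-≤ : ∀ k a b → ∣ b - a ∣ + ∣ b - a ∣ ≤ midDist k a + midDist k b
gap-midDist-≤ k a b with gap-midDist k a b
... | inj₁ (_ , eq) = ≤-reflexive eq
... | inj₂ (_ , lt) = <⇒≤ lt

gap-midDist-≡⇔ : ∀ k a b → (∣ b - a ∣ + ∣ b - a ∣ ≡ midDist k a + midDist k b) ⇔ Straddles k a b
gap-midDist-≡⇔ k a b with gap-midDist k a b
... | inj₁ (straddles , eq)  = mk⇔ (λ _ → straddles) (λ _ → eq)
... | inj₂ (¬straddles , lt) = mk⇔ (λ eq → ⊥-elim (<⇒≢ lt eq)) (λ s → ⊥-elim (¬straddles s))

sumAdj-+ : ∀ m v (f g : ℕ → ℕ → ℕ) →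
  sumAdj m v (λ a b → f a b + g a b) ≡ sumAdj m v f + sumAdj m v g
sumAdj-+ zero    v f g = refl
sumAdj-+ (suc m) v f g =
  trans (cong (f a b + g a b +_) (sumAdj-+ m (v ∘ fsuc) f g)) (lemma (f a b) (g a b) _ _)
  where
  a b : ℕ
  a = v zero
  b = v (fsuc zero)
  lemma : ∀ p q r s → p + q + (r + s) ≡ p + r + (q + s)
  lemma = solve-∀

sumAdj-mono-≤ : ∀ m v (f g : ℕ → ℕ → ℕ) → (∀ a b → f a b ≤ g a b) →
  sumAdj m v f ≤ sumAdj m v g
sumAdj-mono-≤ zero    v f g f≤g = z≤n
sumAdj-mono-≤ (suc m) v f g f≤g = +-mono-≤ (f≤g _ _) (sumAdj-mono-≤ m (v ∘ fsuc) f g f≤g)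

sumAdj-cong : ∀ m v (f g : ℕ → ℕ → ℕ) → allAdj m v (λ a b → f a b ≡ g a b) →
  sumAdj m v f ≡ sumAdj m v g
sumAdj-cong zero    v f g _           = refl
sumAdj-cong (suc m) v f g (eq , eqs) = cong₂ _+_ eq (sumAdj-cong m (v ∘ fsuc) f g eqs)

sumAdj-mono-≡⇒allAdj : ∀ m v (f g : ℕ → ℕ → ℕ) → (∀ a b → f a b ≤ g a b) →
  sumAdj m v f ≡ sumAdj m v g → allAdj m v (λ a b → f a b ≡ g a b)
sumAdj-mono-≡⇒allAdj zero    v f g f≤g _  = tt
sumAdj-mono-≡⇒allAdj (suc m) v f g f≤g eq =
  let head , tail = +-≡-split (f≤g _ _) (sumAdj-mono-≤ m (v ∘ fsuc) f g f≤g) eq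
  in head , sumAdj-mono-≡⇒allAdj m (v ∘ fsuc) f g f≤g tail

allAdj-map : ∀ m v {P Q : ℕ → ℕ → Set} → (∀ a b → P a b → Q a b) → allAdj m v P → allAdj m v Q
allAdj-map zero    v P⇒Q _          = tt
allAdj-map (suc m) v P⇒Q (p , ps) = P⇒Q _ _ p , allAdj-map m (v ∘ fsuc) P⇒Q ps

allAdj-tabulate : ∀ m v (P : ℕ → ℕ → Set) → (∀ i → P (v (inject₁ i)) (v (fsuc i))) → allAdj m v P
allAdj-tabulate zero    v P p = tt
allAdj-tabulate (suc m) v P p = p zero , allAdj-tabulate m (v ∘ fsuc) P (p ∘ fsuc)

-- Interior vertices of the path v lie on two adjacent pairs, the endpoints on one.
sumAdj-endpoints : ∀ m v (g : ℕ → ℕ) →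
  sumAdj m v (λ a b → g a + g b) + (g (v zero) + g (v (fromℕ m))) ≡ sum (g ∘ v) + sum (g ∘ v)
sumAdj-endpoints zero    v g = lemma (g (v zero))
  where
  lemma : ∀ x → 0 + (x + x) ≡ x + 0 + (x + 0)
  lemma = solve-∀
sumAdj-endpoints (suc m) v g = begin
  g₀ + g₁ + S + (g₀ + gₗ)   ≡⟨ lemma g₀ g₁ S gₗ ⟩
  g₀ + g₀ + (S + (g₁ + gₗ)) ≡⟨ cong (g₀ + g₀ +_) (sumAdj-endpoints m (v ∘ fsuc) g) ⟩
  g₀ + g₀ + (T + T)         ≡⟨ lemma′ g₀ T ⟩
  g₀ + T + (g₀ + T)         ∎
  where
  g₀ g₁ gₗ S T : ℕ
  g₀ = g (v zero)
  g₁ = g (v (fsuc zero))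
  gₗ = g (v (fromℕ (suc m)))
  S = sumAdj m (v ∘ fsuc) (λ a b → g a + g b)
  T = sum (g ∘ v ∘ fsuc)
  lemma : ∀ a b s l → a + b + s + (a + l) ≡ a + a + (s + (b + l))
  lemma = solve-∀
  lemma′ : ∀ a t → a + a + (t + t) ≡ a + t + (a + t)
  lemma′ = solve-∀

sumBelow : ℕ → (ℕ → ℕ) → ℕ
sumBelow zero    f = 0
sumBelow (suc n) f = f 0 + sumBelow n (f ∘ suc)

sum-toℕ : ∀ n (g : ℕ → ℕ) → sum {n} (g ∘ toℕ) ≡ sumBelow n g
sum-toℕ zero    g = refl
sum-toℕ (suc n) g = cong (g 0 +_) (sum-toℕ n (g ∘ suc))

sumBelow-suc : ∀ n f → sumBelow (suc n) f ≡ sumBelow n f + f n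
sumBelow-suc zero    f = +-comm (f 0) 0
sumBelow-suc (suc n) f = trans (cong (f 0 +_) (sumBelow-suc n (f ∘ suc))) (sym (+-assoc (f 0) _ _))

sumBelow-cong : ∀ n {f g} → (∀ i → f i ≡ g i) → sumBelow n f ≡ sumBelow n g
sumBelow-cong zero    f≗g = refl
sumBelow-cong (suc n) f≗g = cong₂ _+_ (f≗g 0) (sumBelow-cong n (f≗g ∘ suc))

-- 1 + 3 + ⋯ + (2k − 1) on each side of the midpoint.
sumBelow-midDist : ∀ k → sumBelow (k + k) (midDist k ∘ suc) ≡ k * k + k * k
sumBelow-midDist zero    = refl
sumBelow-midDist (suc k) = begin
  sumBelow (suc k + suc k) f                                  ≡⟨ cong (λ n → sumBelow (suc n) f) (+-suc k k) ⟩
  f 0 + sumBelow (suc (k + k)) (f ∘ suc)                      ≡⟨ cong (f 0 +_) (sumBelow-suc (k + k) (f ∘ suc)) ⟩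
  f 0 + (sumBelow (k + k) (f ∘ suc) + f (suc (k + k)))        ≡⟨ cong (λ s → f 0 + (s + f (suc (k + k))))
                                                                   (sumBelow-cong (k + k) (midDist-suc k ∘ suc)) ⟩
  f 0 + (sumBelow (k + k) (midDist k ∘ suc) + f (suc (k + k))) ≡⟨ cong₂ (λ d s → d + (s + f (suc (k + k))))
                                                                   (midDist-below (suc k) 1 refl) (sumBelow-midDist k) ⟩
  suc (k + k) + (k * k + k * k + f (suc (k + k)))             ≡⟨ cong (λ d → suc (k + k) + (k * k + k * k + d))
                                                                   (midDist-above (suc k) (suc (suc (k + k))) refl) ⟩
  suc (k + k) + (k * k + k * k + suc (k + k))                 ≡⟨ lemma k ⟩
  suc k * suc k + suc k * suc k                               ∎
  where
  f : ℕ → ℕ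
  f = midDist (suc k) ∘ suc
  lemma : ∀ k → suc (k + k) + (k * k + k * k + suc (k + k)) ≡ suc k * suc k + suc k * suc k
  lemma = solve-∀

sum-val : ∀ {n} (g : ℕ → ℕ) (π : Permutation′ n) → sum (g ∘ val π) ≡ sumBelow n (g ∘ suc)
sum-val {n} g π = trans (sym (sum-permute (g ∘ suc ∘ toℕ) π)) (sum-toℕ n (g ∘ suc))

val-injective : ∀ {n} (π : Permutation′ n) {p q} → val π p ≡ val π q → p ≡ q
val-injective π {p} {q} eq = begin
  p                        ≡⟨ inverseˡ π ⟨
  π ⟨$⟩ˡ (π ⟨$⟩ʳ p)        ≡⟨ cong (π ⟨$⟩ˡ_) (toℕ-injective (suc-injective eq)) ⟩
  π ⟨$⟩ˡ (π ⟨$⟩ʳ q)        ≡⟨ inverseˡ π ⟩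
  q                        ∎

midDistPathSum : ∀ k m → Permutation′ (suc m) → ℕ
midDistPathSum k m π = sumAdj m (val π) (λ a b → midDist k a + midDist k b)

endMidDist : ∀ k m → Permutation′ (suc m) → ℕ
endMidDist k m π = midDist k (val π zero) + midDist k (val π (fromℕ m))

EndsAtMiddle : ∀ k m → Permutation′ (suc m) → Set
EndsAtMiddle k m π = (val π zero ≡ k × val π (fromℕ m) ≡ suc k)
                   ⊎ (val π zero ≡ suc k × val π (fromℕ m) ≡ k)

midDistPathSum+endMidDist : ∀ k {m} → suc m ≡ 2 * k → (π : Permutation′ (suc m)) →
  midDistPathSum k m π + endMidDist k m π ≡ suc m * suc m
midDistPathSum+endMidDist k {m} n≡2k π = begin
  midDistPathSum k m π + endMidDist k m π ≡⟨ sumAdj-endpoints m (val π) (midDist k) ⟩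
  S + S                                   ≡⟨ cong (λ s → s + s) S≡2k² ⟩
  k * k + k * k + (k * k + k * k)         ≡⟨ lemma k ⟩
  2 * k * (2 * k)                         ≡⟨ cong₂ _*_ n≡2k n≡2k ⟨
  suc m * suc m                           ∎
  where
  S : ℕ
  S = sum (midDist k ∘ val π)
  S≡2k² : S ≡ k * k + k * k
  S≡2k² = begin
    S                                  ≡⟨ sum-val (midDist k) π ⟩
    sumBelow (suc m) (midDist k ∘ suc) ≡⟨ cong (λ n → sumBelow n (midDist k ∘ suc))
                                            (trans n≡2k (cong (k +_) (+-identityʳ k))) ⟩
    sumBelow (k + k) (midDist k ∘ suc) ≡⟨ sumBelow-midDist k ⟩
    k * k + k * k                      ∎
  lemma : ∀ k → k * k + k * k + (k * k + k * k) ≡ 2 * k * (2 * k)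
  lemma = solve-∀

Δ+Δ≤midDistPathSum : ∀ k m π → Δ m π + Δ m π ≤ midDistPathSum k m π
Δ+Δ≤midDistPathSum k m π = subst (_≤ midDistPathSum k m π) (sumAdj-+ m (val π) gap gap)
  (sumAdj-mono-≤ m (val π) _ _ (gap-midDist-≤ k))
  where
  gap : ℕ → ℕ → ℕ
  gap a b = ∣ b - a ∣

Δ+Δ≡midDistPathSum⇔ : ∀ k m π → (Δ m π + Δ m π ≡ midDistPathSum k m π) ⇔ MidAlternating k m π
Δ+Δ≡midDistPathSum⇔ k m π = mk⇔ to from
  where
  gap : ℕ → ℕ → ℕ
  gap a b = ∣ b - a ∣
  doubled : sumAdj m (val π) (λ a b → gap a b + gap a b) ≡ Δ m π + Δ m π
  doubled = sumAdj-+ m (val π) gap gap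
  to : Δ m π + Δ m π ≡ midDistPathSum k m π → MidAlternating k m π
  to eq = allAdj-map m (val π) (λ a b → Equivalence.to (gap-midDist-≡⇔ k a b))
    (sumAdj-mono-≡⇒allAdj m (val π) _ _ (gap-midDist-≤ k) (trans doubled eq))
  from : MidAlternating k m π → Δ m π + Δ m π ≡ midDistPathSum k m π
  from alt = trans (sym doubled) (sumAdj-cong m (val π) _ _
    (allAdj-map m (val π) (λ a b → Equivalence.from (gap-midDist-≡⇔ k a b)) alt))

2≤endMidDist : ∀ k m π → 2 ≤ endMidDist k m π
2≤endMidDist k m π = +-mono-≤ (1≤midDist k (val π zero)) (1≤midDist k (val π (fromℕ m)))

endMidDist≡2⇔ : ∀ k m π → 1 ≤ m → (endMidDist k m π ≡ 2) ⇔ EndsAtMiddle k m π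
endMidDist≡2⇔ k m π 1≤m = mk⇔ to from
  where
  first last : ℕ
  first = val π zero
  last = val π (fromℕ m)
  distinct : first ≢ last
  distinct first≡last = <⇒≢ 1≤m (trans (cong toℕ (val-injective π first≡last)) (toℕ-fromℕ m))
  to : endMidDist k m π ≡ 2 → EndsAtMiddle k m π
  to eq with +-≡-split (1≤midDist k first) (1≤midDist k last) (sym eq)
  ... | 1≡first , 1≡last
    with Equivalence.to (midDist≡1⇔ k first) (sym 1≡first) | Equivalence.to (midDist≡1⇔ k last) (sym 1≡last)
  ... | inj₁ first≡k   | inj₂ last≡1+k = inj₁ (first≡k , last≡1+k)
  ... | inj₂ first≡1+k | inj₁ last≡k   = inj₂ (first≡1+k , last≡k)
  ... | inj₁ first≡k   | inj₁ last≡k   = ⊥-elim (distinct (trans first≡k (sym last≡k)))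
  ... | inj₂ first≡1+k | inj₂ last≡1+k = ⊥-elim (distinct (trans first≡1+k (sym last≡1+k)))
  from : EndsAtMiddle k m π → endMidDist k m π ≡ 2
  from (inj₁ (first≡k , last≡1+k)) = cong₂ _+_ (Equivalence.from (midDist≡1⇔ k first) (inj₁ first≡k))
                                               (Equivalence.from (midDist≡1⇔ k last) (inj₂ last≡1+k))
  from (inj₂ (first≡1+k , last≡k)) = cong₂ _+_ (Equivalence.from (midDist≡1⇔ k first) (inj₂ first≡1+k))
                                               (Equivalence.from (midDist≡1⇔ k last) (inj₁ last≡k))

Δ-maximum : ∀ k m → 1 ≤ k → suc m ≡ 2 * k → (π : Permutation′ (suc m)) →
  let N = (suc m * suc m ∸ 2) / 2 in
  Δ m π ≤ N × (Δ m π ≡ N ⇔ (MidAlternating k m π × EndsAtMiddle k m π))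
Δ-maximum k m 1≤k n≡2k π =
    halve-bound Δ+Δ≤ 2≤ total
  , (Δ+Δ≡midDistPathSum⇔ k m π ×-⇔ endMidDist≡2⇔ k m π 1≤m) ⇔-∘ halve-bound-≡⇔ Δ+Δ≤ 2≤ total
  where
  N : ℕ
  N = (suc m * suc m ∸ 2) / 2
  Δ+Δ≤ : Δ m π + Δ m π ≤ midDistPathSum k m π
  Δ+Δ≤ = Δ+Δ≤midDistPathSum k m π
  2≤ : 2 ≤ endMidDist k m π
  2≤ = 2≤endMidDist k m π
  total : midDistPathSum k m π + endMidDist k m π ≡ N + N + 2
  total = trans (midDistPathSum+endMidDist k n≡2k π) (sym (half-n²∸2 k 1≤k n≡2k))
  1≤m : 1 ≤ m
  1≤m = s≤s⁻¹ (≤-trans (*-monoʳ-≤ 2 1≤k) (≤-reflexive (sym n≡2k)))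

-- Sends position 2j + b (b < 2) to value k·b + (k − 1 − j), counting from 0.
interleave : ∀ k → Permutation (k * 2) (2 * k)
interleave k =
  ↔-sym (*↔× {2} {k}) ↔-∘ (×-comm (Fin k) (Fin 2) ↔-∘ ((reverse ×-↔ ↔-id (Fin 2)) ↔-∘ *↔× {k} {2}))

zigzag : ∀ k {m} → suc m ≡ 2 * k → Permutation′ (suc m)
zigzag k n≡2k = cast-id (trans n≡2k (*-comm 2 k)) ∘ₚ interleave k ∘ₚ cast-id (sym n≡2k)

zigzag-entry : ∀ k {m} (n≡2k : suc m ≡ 2 * k) p → ∃₂ λ (j : Fin k) (b : Fin 2) →
  toℕ p ≡ 2 * toℕ j + toℕ b × val (zigzag k n≡2k) p ≡ suc (k * toℕ b + toℕ (opposite j))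
zigzag-entry k n≡2k p = j , b , position , cong suc (trans (toℕ-cast _ _) (toℕ-combine b (opposite j)))
  where
  q : Fin (k * 2)
  q = cast (trans n≡2k (*-comm 2 k)) p
  j : Fin k
  j = proj₁ (remQuot {k} 2 q)
  b : Fin 2
  b = proj₂ (remQuot {k} 2 q)
  position : toℕ p ≡ 2 * toℕ j + toℕ b
  position = trans (sym (toℕ-cast _ p)) (trans (cong toℕ (sym (combine-remQuot {k} 2 q))) (toℕ-combine j b))

zigzag-side : ∀ k {m} (n≡2k : suc m ≡ 2 * k) p →
    (∃ λ j → toℕ p ≡ 2 * j × val (zigzag k n≡2k) p ≤ k)
  ⊎ (∃ λ j → toℕ p ≡ suc (2 * j) × suc k ≤ val (zigzag k n≡2k) p)
zigzag-side k n≡2k p with zigzag-entry k n≡2k p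
... | j , zero , p≡2j , v≡ =
  inj₁ (toℕ j , trans p≡2j (+-identityʳ _) , ≤-trans (≤-reflexive v≡) low)
  where
  low : suc (k * 0 + toℕ (opposite j)) ≤ k
  low = subst (λ z → suc (z + toℕ (opposite j)) ≤ k) (sym (*-zeroʳ k)) (toℕ<n (opposite j))
... | j , fsuc zero , p≡2j+1 , v≡ =
  inj₂ (toℕ j , trans p≡2j+1 (+-comm _ 1) , ≤-trans high (≤-reflexive (sym v≡)))
  where
  high : suc k ≤ suc (k * 1 + toℕ (opposite j))
  high = s≤s (subst (_≤ k * 1 + toℕ (opposite j)) (*-identityʳ k) (m≤m+n (k * 1) _))

zigzag-midAlternating : ∀ k {m} (n≡2k : suc m ≡ 2 * k) → MidAlternating k m (zigzag k n≡2k)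
zigzag-midAlternating k {m} n≡2k = allAdj-tabulate m (val (zigzag k n≡2k)) (Straddles k) adjacent
  where
  adjacent : ∀ i → Straddles k (val (zigzag k n≡2k) (inject₁ i)) (val (zigzag k n≡2k) (fsuc i))
  adjacent i with zigzag-side k n≡2k (inject₁ i) | zigzag-side k n≡2k (fsuc i)
  ... | inj₁ (_ , _ , low) | inj₂ (_ , _ , high) = inj₁ (low , high)
  ... | inj₂ (_ , _ , high) | inj₁ (_ , _ , low) = inj₂ (high , low)
  ... | inj₁ (j , i≡2j , _) | inj₁ (j′ , 1+i≡2j′ , _) =
    ⊥-elim (even≢odd j′ j (trans (sym 1+i≡2j′) (cong suc (trans (sym (toℕ-inject₁ i)) i≡2j))))
  ... | inj₂ (j , i≡1+2j , _) | inj₂ (j′ , 1+i≡1+2j′ , _) =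
    ⊥-elim (even≢odd j′ j (trans (sym (suc-injective 1+i≡1+2j′)) (trans (sym (toℕ-inject₁ i)) i≡1+2j)))

zigzag-first : ∀ k {m} (n≡2k : suc m ≡ 2 * k) → val (zigzag k n≡2k) zero ≡ k
zigzag-first zero    ()
zigzag-first (suc k) n≡2k with zigzag-entry (suc k) n≡2k zero
... | zero , zero , _ , v≡ =
  trans v≡ (cong suc (trans (cong (_+ toℕ (fromℕ k)) (*-zeroʳ k)) (toℕ-fromℕ k)))
... | zero , fsuc zero , () , _
... | fsuc _ , _ , () , _

zigzag-last : ∀ k {m} (n≡2k : suc m ≡ 2 * k) → val (zigzag k n≡2k) (fromℕ m) ≡ suc k
zigzag-last k {m} n≡2k with zigzag-entry k n≡2k (fromℕ m)
... | j , zero , m≡2j , _ =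
  ⊥-elim (even≢odd k (toℕ j)
    (trans (sym n≡2k) (cong suc (trans (sym (toℕ-fromℕ m)) (trans m≡2j (+-identityʳ _))))))
... | j , fsuc zero , m≡2j+1 , v≡ =
  trans v≡ (cong suc (trans (cong₂ _+_ (*-identityʳ k) opposite≡0) (+-identityʳ k)))
  where
  1+j≡k : suc (toℕ j) ≡ k
  1+j≡k = *-cancelˡ-≡ (suc (toℕ j)) k 2
    (trans (lemma (toℕ j)) (trans (cong suc (trans (sym m≡2j+1) (toℕ-fromℕ m))) n≡2k))
    where
    lemma : ∀ j → 2 * suc j ≡ suc (2 * j + 1)
    lemma = solve-∀
  opposite≡0 : toℕ (opposite j) ≡ 0
  opposite≡0 = trans (opposite-prop j) (trans (cong (k ∸_) 1+j≡k) (n∸n≡0 k))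

theorem3p3 : (k m : ℕ) → 1 ≤ k → suc m ≡ 2 * k →
    ((∀ (π : Permutation′ (suc m)) → Δ m π ≤ ((suc m * suc m) ∸ 2) / 2)
      × Σ (Permutation′ (suc m)) (λ π → Δ m π ≡ ((suc m * suc m) ∸ 2) / 2))
    × (∀ (π : Permutation′ (suc m)) →
        (Δ m π ≡ ((suc m * suc m) ∸ 2) / 2) ⇔
        (MidAlternating k m π
          × ((val π zero ≡ k × val π (fromℕ m) ≡ suc k)
             ⊎ (val π zero ≡ suc k × val π (fromℕ m) ≡ k))))
theorem3p3 k m 1≤k n≡2k =
  ( (λ π → proj₁ (Δ-maximum k m 1≤k n≡2k π))
  , zigzag k n≡2k
  , Equivalence.from (proj₂ (Δ-maximum k m 1≤k n≡2k (zigzag k n≡2k)))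
      (zigzag-midAlternating k n≡2k , inj₁ (zigzag-first k n≡2k , zigzag-last k n≡2k)) )
  , λ π → proj₂ (Δ-maximum k m 1≤k n≡2k π)
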